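{- Let $\overline{P_n}$ be the complement of the path $P_n$ of order $n\geq 4$. Then $\chi_d^t(\overline{P_n})=3$ if $n=4$, and $\chi_d^t(\overline{P_n})=\lceil n/2\rceil$ if $n\geq 5$.
   Context: The complement $\overline{G}$ of a graph $G$ has vertex set $V(G)$, with $vw$ an edge iff $vw\notin E(G)$. A total dominator coloring of a graph $G$ is a proper vertex coloring of $G$ in which each vertex of $G$ is adjacent to every vertex of some color class; $\chi_d^t(G)$ is the minimum number of color classes in a total dominator coloring of $G$. -}

module Defs where

open import Data.Nat using (ℕ; suc; _≤_)
open import Data.Fin using (Fin; toℕ)
open import Data.Product using (Σ; ∃; _×_)
open import Data.Sum using (_⊎_)
open import Relation.Nullary using (¬_)
open import Relation.Binary.PropositionalEquality using (_≡_; _≢_)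

PathAdj : {n : ℕ} → Fin n → Fin n → Set
PathAdj i j = (toℕ j ≡ suc (toℕ i)) ⊎ (toℕ i ≡ suc (toℕ j))

complementAdj : {n : ℕ} → (Fin n → Fin n → Set) → Fin n → Fin n → Set
complementAdj A v w = (v ≢ w) × ¬ A v w

coPathAdj : {n : ℕ} → Fin n → Fin n → Set
coPathAdj = complementAdj PathAdj

-- A total dominator coloring with exactly k color classes:
-- c : V → Fin k is a proper coloring, every color is used (so there are
-- exactly k nonempty color classes), and every vertex v is adjacent to
-- every vertex of some color class.
record IsTDC {n : ℕ} (Adj : Fin n → Fin n → Set) (k : ℕ) (c : Fin n → Fin k) : Set where
  field
    proper    : ∀ v w → Adj v w → c v ≢ c w
    surj      : ∀ (a : Fin k) → ∃ λ v → c v ≡ a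
    dominates : ∀ v → ∃ λ (a : Fin k) → ∀ u → c u ≡ a → Adj v u

HasTDC : {n : ℕ} → (Fin n → Fin n → Set) → ℕ → Set
HasTDC {n} Adj k = Σ (Fin n → Fin k) (IsTDC Adj k)

TotalDomChromaticNumber : {n : ℕ} → (Fin n → Fin n → Set) → ℕ → Set
TotalDomChromaticNumber Adj k = HasTDC Adj k × (∀ m → HasTDC Adj m → k ≤ m)

module Submission where

-- The even vertices 0, 2, …, 2(⌈n/2⌉−1) are pairwise
-- at distance ≥ 2, so they form a clique of size ⌈n/2⌉ in P̄ₙ; a proper
-- colouring is injective on a clique, hence every TDC has ≥ ⌈n/2⌉ colours.
--
-- Colour v by ⌊v/2⌋.  Each class {2a, 2a+1} is a pair of
-- consecutive vertices, so the colouring is proper in P̄ₙ and uses ⌈n/2⌉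
-- colours.  Vertices v ≤ 2 are adjacent to all of class 2 = {4, 5}, and
-- vertices v ≥ 3 to all of class 0 = {0, 1}.
--
-- n = 4.  The colouring {0}, {1,2}, {3} (i.e. v ↦ ⌈v/2⌉) is a TDC.  No TDC with
-- two colours exists: vertex 1 must dominate a class avoiding 1 and 2, so 1 and
-- 2 share a colour; vertex 3 is adjacent to 0 and 1, so 0 and 1 share a
-- colour; but 0 and 2 are adjacent.

open import Defs
open import Data.Nat using (ℕ; zero; suc; _≤_; _<_; _+_; _/_; z≤n; s≤s; ⌊_/2⌋; ⌈_/2⌉; _≤?_)
open import Data.Nat.Properties
  using (≤-refl; ≤-trans; n≤1+n; n<1+n; <-irrefl; <-asym; <-cmp; ≰⇒>; <⇒≱; ≤∧≢⇒<;
         +-comm; +-suc; +-mono-≤; +-monoʳ-≤; suc-injective;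
         ⌊n/2⌋-mono; ⌈n/2⌉-mono; n≡⌊n+n/2⌋; n≡⌈n+n/2⌉)
open import Data.Nat.DivMod using (m/n≡1+[m∸n]/n)
open import Data.Fin using (Fin; toℕ; fromℕ<; _≟_) renaming (zero to f0; suc to fs)
open import Data.Fin.Properties using (toℕ-injective; toℕ-fromℕ<; toℕ<n; injective⇒≤)
open import Data.Product using (_×_; ∃; _,_; proj₁; proj₂)
open import Data.Sum using (_⊎_; inj₁; inj₂; swap) renaming (map to ⊎-map)
open import Data.Empty using (⊥-elim)
open import Relation.Nullary using (¬_; yes; no)
open import Relation.Binary.Definitions using (tri<; tri≈; tri>)
open import Relation.Binary.PropositionalEquality
  using (_≡_; _≢_; refl; sym; trans; cong; subst; subst₂; module ≡-Reasoning)

pattern f1 = fs f0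
pattern f2 = fs (fs f0)
pattern f3 = fs (fs (fs f0))

⌊n/2⌋≡n/2 : ∀ n → ⌊ n /2⌋ ≡ n / 2
⌊n/2⌋≡n/2 zero = refl
⌊n/2⌋≡n/2 (suc zero) = refl
⌊n/2⌋≡n/2 (suc (suc n)) =
  trans (cong suc (⌊n/2⌋≡n/2 n)) (sym (m/n≡1+[m∸n]/n {suc (suc n)} {2} (s≤s (s≤s z≤n))))

⌈n/2⌉≡[n+1]/2 : ∀ n → ⌈ n /2⌉ ≡ (n + 1) / 2
⌈n/2⌉≡[n+1]/2 n = trans (⌊n/2⌋≡n/2 (suc n)) (cong (_/ 2) (+-comm 1 n))

sameHalf : ∀ a b → ⌊ a /2⌋ ≡ ⌊ b /2⌋ → a ≡ b ⊎ (b ≡ suc a ⊎ a ≡ suc b)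
sameHalf zero zero _ = inj₁ refl
sameHalf zero (suc zero) _ = inj₂ (inj₁ refl)
sameHalf (suc zero) zero _ = inj₂ (inj₂ refl)
sameHalf (suc zero) (suc zero) _ = inj₁ refl
sameHalf zero (suc (suc b)) ()
sameHalf (suc zero) (suc (suc b)) ()
sameHalf (suc (suc a)) zero ()
sameHalf (suc (suc a)) (suc zero) ()
sameHalf (suc (suc a)) (suc (suc b)) eq =
  ⊎-map (cong (2 +_)) (⊎-map (cong (2 +_)) (cong (2 +_))) (sameHalf a b (suc-injective eq))

⌊n/2⌋≡0⇒n≤1 : ∀ n → ⌊ n /2⌋ ≡ 0 → n ≤ 1
⌊n/2⌋≡0⇒n≤1 zero _ = z≤n
⌊n/2⌋≡0⇒n≤1 (suc zero) _ = s≤s z≤n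
⌊n/2⌋≡0⇒n≤1 (suc (suc n)) ()

⌊n/2⌋≡2⇒4≤n : ∀ n → ⌊ n /2⌋ ≡ 2 → 4 ≤ n
⌊n/2⌋≡2⇒4≤n (suc (suc (suc (suc n)))) _ = s≤s (s≤s (s≤s (s≤s z≤n)))
⌊n/2⌋≡2⇒4≤n zero ()
⌊n/2⌋≡2⇒4≤n (suc zero) ()
⌊n/2⌋≡2⇒4≤n (suc (suc zero)) ()
⌊n/2⌋≡2⇒4≤n (suc (suc (suc zero))) ()

double< : ∀ {i n} → i < ⌈ n /2⌉ → i + i < n
double< {i} {n} i<⌈n/2⌉ = ≰⇒> λ n≤i+i →
  <⇒≱ i<⌈n/2⌉ (subst (⌈ n /2⌉ ≤_) (sym (n≡⌈n+n/2⌉ i)) (⌈n/2⌉-mono n≤i+i))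

double-far : ∀ {a b} → a < b → 2 + (a + a) ≤ b + b
double-far {a} {b} a<b = subst (_≤ b + b) (cong suc (+-suc a a)) (+-mono-≤ a<b a<b)

IsClique : ∀ {n k} → (Fin n → Fin n → Set) → (Fin k → Fin n) → Set
IsClique {k = k} Adj e = ∀ (i j : Fin k) → i ≢ j → Adj (e i) (e j)

-- A proper colouring is injective on a clique, so a TDC needs at least as many
-- colours as the clique has vertices.
clique≤colours : ∀ {n k m} {Adj : Fin n → Fin n → Set} {e : Fin k → Fin n} →
                 IsClique Adj e → HasTDC Adj m → k ≤ m
clique≤colours {e = e} clique (c , tdc) = injective⇒≤ injective
  where
  injective : ∀ {i j} → c (e i) ≡ c (e j) → i ≡ j
  injective {i} {j} same with i ≟ j
  ... | yes i≡j = i≡j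
  ... | no i≢j = ⊥-elim (IsTDC.proper tdc (e i) (e j) (clique i j i≢j) same)

coPathAdj-sym : ∀ {n} {v w : Fin n} → coPathAdj v w → coPathAdj w v
coPathAdj-sym (v≢w , ¬vw) = (λ w≡v → v≢w (sym w≡v)) , (λ wv → ¬vw (swap wv))

far⇒coPathAdj : ∀ {n} {v w : Fin n} → 2 + toℕ v ≤ toℕ w → coPathAdj v w
far⇒coPathAdj {v = v} {w} far = distinct , nonConsecutive
  where
  v<w : toℕ v < toℕ w
  v<w = ≤-trans (n≤1+n (suc (toℕ v))) far
  distinct : v ≢ w
  distinct v≡w = <-irrefl (cong toℕ v≡w) v<w
  nonConsecutive : ¬ PathAdj v w
  nonConsecutive (inj₁ w≡1+v) = <-irrefl refl (subst (2 + toℕ v ≤_) w≡1+v far)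
  nonConsecutive (inj₂ v≡1+w) = <-asym v<w (subst (toℕ w <_) (sym v≡1+w) (n<1+n (toℕ w)))

pathClasses⇒proper : ∀ {n k} (c : Fin n → Fin k) →
                     (∀ v w → c v ≡ c w → v ≡ w ⊎ PathAdj v w) →
                     ∀ v w → coPathAdj v w → c v ≢ c w
pathClasses⇒proper c classes v w (v≢w , ¬vw) same with classes v w same
... | inj₁ v≡w = v≢w v≡w
... | inj₂ vw = ¬vw vw

sameHalf⇒pathClass : ∀ {n} (v w : Fin n) → ⌊ toℕ v /2⌋ ≡ ⌊ toℕ w /2⌋ → v ≡ w ⊎ PathAdj v w
sameHalf⇒pathClass v w eq = ⊎-map toℕ-injective (λ vw → vw) (sameHalf (toℕ v) (toℕ w) eq)

evens : ∀ {n} → Fin ⌈ n /2⌉ → Fin n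
evens i = fromℕ< (double< (toℕ<n i))

evens-toℕ : ∀ {n} (i : Fin ⌈ n /2⌉) → toℕ (evens {n} i) ≡ toℕ i + toℕ i
evens-toℕ i = toℕ-fromℕ< (double< (toℕ<n i))

evens-far : ∀ {n} {i j : Fin ⌈ n /2⌉} → toℕ i < toℕ j → coPathAdj (evens {n} i) (evens j)
evens-far {i = i} {j} i<j = far⇒coPathAdj
  (subst₂ (λ x y → 2 + x ≤ y) (sym (evens-toℕ i)) (sym (evens-toℕ j)) (double-far i<j))

evens-clique : ∀ {n} → IsClique coPathAdj (evens {n})
evens-clique i j i≢j with <-cmp (toℕ i) (toℕ j)
... | tri< i<j _ _ = evens-far i<j
... | tri≈ _ i≡j _ = ⊥-elim (i≢j (toℕ-injective i≡j))
... | tri> _ _ j<i = coPathAdj-sym (evens-far j<i)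

lowerBound : ∀ {n m} → HasTDC (coPathAdj {n}) m → ⌈ n /2⌉ ≤ m
lowerBound = clique≤colours evens-clique

halving : ∀ {n} → Fin n → Fin ⌈ n /2⌉
halving v = fromℕ< (⌊n/2⌋-mono (s≤s (toℕ<n v)))

halving-toℕ : ∀ {n} (v : Fin n) → toℕ (halving v) ≡ ⌊ toℕ v /2⌋
halving-toℕ v = toℕ-fromℕ< (⌊n/2⌋-mono (s≤s (toℕ<n v)))

halving-class : ∀ {n c} (u : Fin n) (c< : c < ⌈ n /2⌉) → halving u ≡ fromℕ< c< → ⌊ toℕ u /2⌋ ≡ c
halving-class u c< same = trans (sym (halving-toℕ u)) (trans (cong toℕ same) (toℕ-fromℕ< c<))

-- Every colour a is used, namely by the even vertex 2a.
halving-surjective : ∀ {n} (a : Fin ⌈ n /2⌉) → ∃ λ v → halving v ≡ a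
halving-surjective {n} a = evens a , toℕ-injective (begin
  toℕ (halving (evens a))  ≡⟨ halving-toℕ (evens a) ⟩
  ⌊ toℕ (evens {n} a) /2⌋  ≡⟨ cong ⌊_/2⌋ (evens-toℕ a) ⟩
  ⌊ toℕ a + toℕ a /2⌋      ≡⟨ sym (n≡⌊n+n/2⌋ (toℕ a)) ⟩
  toℕ a                    ∎)
  where open ≡-Reasoning

-- With n ≥ 5 there are at least three colours; vertices 0, 1, 2 dominate
-- class 2 = {4, 5} and the others dominate class 0 = {0, 1}.
halving-dominates : ∀ {n} → 5 ≤ n → ∀ (v : Fin n) →
                    ∃ λ (a : Fin ⌈ n /2⌉) → ∀ u → halving u ≡ a → coPathAdj v u
halving-dominates {n} 5≤n v with toℕ v ≤? 2
... | yes v≤2 = fromℕ< 2< , λ u same → far⇒coPathAdj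
  (≤-trans (+-monoʳ-≤ 2 v≤2) (⌊n/2⌋≡2⇒4≤n (toℕ u) (halving-class u 2< same)))
  where
  2< : 2 < ⌈ n /2⌉
  2< = ⌈n/2⌉-mono 5≤n
... | no v≰2 = fromℕ< 0< , λ u same → coPathAdj-sym (far⇒coPathAdj
  (≤-trans (+-monoʳ-≤ 2 (⌊n/2⌋≡0⇒n≤1 (toℕ u) (halving-class u 0< same))) (≰⇒> v≰2)))
  where
  0< : 0 < ⌈ n /2⌉
  0< = ≤-trans (s≤s z≤n) (⌈n/2⌉-mono 5≤n)

halving-TDC : ∀ {n} → 5 ≤ n → IsTDC (coPathAdj {n}) ⌈ n /2⌉ halving
halving-TDC 5≤n = record
  { proper    = pathClasses⇒proper halving λ v w same →
                  sameHalf⇒pathClass v w (trans (sym (halving-toℕ v)) (trans (cong toℕ same) (halving-toℕ w)))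
  ; surj      = halving-surjective
  ; dominates = halving-dominates 5≤n
  }

colour4 : Fin 4 → Fin 3
colour4 f0 = f0
colour4 f1 = f1
colour4 f2 = f1
colour4 f3 = f2

colour4-toℕ : ∀ v → toℕ (colour4 v) ≡ ⌈ toℕ v /2⌉
colour4-toℕ f0 = refl
colour4-toℕ f1 = refl
colour4-toℕ f2 = refl
colour4-toℕ f3 = refl

-- Its classes are shifted halving classes, hence single or consecutive vertices.
colour4-classes : ∀ v w → colour4 v ≡ colour4 w → v ≡ w ⊎ PathAdj v w
colour4-classes v w same =
  ⊎-map (λ e → toℕ-injective (suc-injective e)) (⊎-map suc-injective suc-injective)
        (sameHalf (suc (toℕ v)) (suc (toℕ w))
                  (trans (sym (colour4-toℕ v)) (trans (cong toℕ same) (colour4-toℕ w))))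

colour4-TDC : IsTDC (coPathAdj {4}) 3 colour4
colour4-TDC = record
  { proper    = pathClasses⇒proper colour4 colour4-classes
  ; surj      = λ { f0 → f0 , refl ; f1 → f1 , refl ; f2 → f3 , refl }
  ; dominates = λ v → dominated v , dominates v
  }
  where
  -- vertices 0, 1 dominate class {3}; vertices 2, 3 dominate class {0}
  dominated : Fin 4 → Fin 3
  dominated f0 = f2
  dominated f1 = f2
  dominated f2 = f0
  dominated f3 = f0
  dominates : ∀ v u → colour4 u ≡ dominated v → coPathAdj v u
  dominates f0 f3 refl = far⇒coPathAdj (s≤s (s≤s z≤n))
  dominates f1 f3 refl = far⇒coPathAdj ≤-refl
  dominates f2 f0 refl = coPathAdj-sym (far⇒coPathAdj ≤-refl)
  dominates f3 f0 refl = coPathAdj-sym (far⇒coPathAdj (s≤s (s≤s z≤n)))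
  dominates f2 f1 ()
  dominates f2 f2 ()
  dominates f2 f3 ()
  dominates f3 f1 ()
  dominates f3 f2 ()
  dominates f3 f3 ()

differFrom⇒equal : ∀ {x y z : Fin 2} → x ≢ z → y ≢ z → x ≡ y
differFrom⇒equal {f0} {f0} _ _ = refl
differFrom⇒equal {f1} {f1} _ _ = refl
differFrom⇒equal {f0} {f1} {f0} x≢z _ = ⊥-elim (x≢z refl)
differFrom⇒equal {f0} {f1} {f1} _ y≢z = ⊥-elim (y≢z refl)
differFrom⇒equal {f1} {f0} {f0} _ y≢z = ⊥-elim (y≢z refl)
differFrom⇒equal {f1} {f0} {f1} x≢z _ = ⊥-elim (x≢z refl)

noTDC4with2 : ¬ HasTDC (coPathAdj {4}) 2
noTDC4with2 (c , tdc) = proper f0 f2 (far⇒coPathAdj ≤-refl) (trans c0≡c1 c1≡c2)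
  where
  open IsTDC tdc
  -- vertex 3 is adjacent to both 0 and 1
  c0≡c1 : c f0 ≡ c f1
  c0≡c1 = differFrom⇒equal (proper f0 f3 (far⇒coPathAdj (s≤s (s≤s z≤n))))
                           (proper f1 f3 (far⇒coPathAdj ≤-refl))
  -- the class dominated by vertex 1 contains neither 1 nor its path-neighbour 2
  c1≡c2 : c f1 ≡ c f2
  c1≡c2 = differFrom⇒equal (λ c1≡a → proj₁ (dom f1 c1≡a) refl)
                           (λ c2≡a → proj₂ (dom f2 c2≡a) (inj₁ refl))
    where dom = proj₂ (dominates f1)

lowerBound4 : ∀ m → HasTDC (coPathAdj {4}) m → 3 ≤ m
lowerBound4 m tdc = ≤∧≢⇒< (lowerBound tdc)
  (λ 2≡m → noTDC4with2 (subst (HasTDC coPathAdj) (sym 2≡m) tdc))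

proposition4p5 : TotalDomChromaticNumber (coPathAdj {4}) 3
    × (∀ (n : ℕ) → 5 ≤ n → TotalDomChromaticNumber (coPathAdj {n}) ((n + 1) / 2))
proposition4p5 = ((colour4 , colour4-TDC) , lowerBound4) , large
  where
  large : ∀ (n : ℕ) → 5 ≤ n → TotalDomChromaticNumber (coPathAdj {n}) ((n + 1) / 2)
  large n 5≤n = subst (TotalDomChromaticNumber (coPathAdj {n})) (⌈n/2⌉≡[n+1]/2 n)
    ((halving , halving-TDC 5≤n) , λ m → lowerBound)
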